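{- Let $G=(V,E)$ be a graph. Then $\le_G^\sim$ is the maximum co-lex relation and the maximum co-lex order on $G/_{\le_G}$.
   Context: $\Sigma$ is a finite alphabet with a fixed total order $\preceq$. A graph is $G=(V,E)$ with $V$ finite and $E\subseteq V\times V\times\Sigma$. Let $\#\notin\Sigma$ with $\#\prec a$ for all $a\in\Sigma$. For a node $v$ of a graph, $\lambda(v)$ is the set of labels of edges entering $v$ if $v$ has incoming edges, and $\{\#\}$ otherwise. Write $\lambda(u)\,\angle\,\lambda(v)$ iff $a\preceq b$ for all $a\in\lambda(u)$, $b\in\lambda(v)$. A co-lex relation on a graph is a reflexive relation $R$ on its nodes such that (Axiom 1) $u\neq v$, $(u,v)\in R$ implies $\lambda(u)\,\angle\,\lambda(v)$; (Axiom 2) for edges $(u',u,a),(v',v,a)$ with $u\neq v$ and $(u,v)\in R$, $(u',v')\in R$. A co-lex order is a co-lex relation that is a partial order. The maximum co-lex relation (resp. order) on a graph is a co-lex relation (resp. order) containing every co-lex relation (resp. order) on that graph. $\le_G$ denotes the maximum co-lex relation on $G$ (it exists and is a preorder). For a preorder $\le$: $u\sim_\le v$ iff $u\le v$ and $v\le u$; $[v]_\le$ the class; $V/_\le$ the set of classes; $[u]_\le\le^\sim[v]_\le$ iff $u\le v$; $G/_\le=(V/_\le,E/_\le)$ with $E/_\le=\{([u]_\le,[v]_\le,a):(u',v',a)\in E$ for some $u'\in[u]_\le,v'\in[v]_\le\}$. -}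

module Defs where

open import Data.Nat using (ℕ)
open import Data.Fin using (Fin)
open import Data.Fin.Base using () renaming (_≤_ to _≤ᶠ_)
open import Data.Maybe using (Maybe; just; nothing)
open import Data.Bool using (Bool; true)
open import Data.Product using (Σ; _×_; ∃; ∃-syntax)
open import Relation.Nullary using (¬_)
open import Relation.Binary.PropositionalEquality using (_≡_)

-- Alphabet Σ = Fin k with its natural total order (every finite totally
-- ordered set is order-isomorphic to some Fin k).
-- Labels extended with # : represented as Maybe (Fin k), # = nothing,
-- and # ≺ a for every a ∈ Σ.
data _≼_ {k : ℕ} : Maybe (Fin k) → Maybe (Fin k) → Set where
  #≼  : ∀ {y} → nothing ≼ y
  a≼b : ∀ {a b} → a ≤ᶠ b → just a ≼ just b

-- For an ordinary graph, _≈_ is _≡_; for a quotient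
-- graph G/≤, V is the node set of G and _≈_ is ∼≤, so that a relation on
-- classes is a relation on V that respects _≈_.
module CoLex {k : ℕ} {V : Set} (_≈_ : V → V → Set) (E : V → V → Fin k → Set) where

  Lab : V → Maybe (Fin k) → Set
  Lab v (just a) = ∃[ u ] E u v a
  Lab v nothing  = ¬ (∃[ u ] ∃[ a ] E u v a)

  _∠_ : V → V → Set
  u ∠ v = ∀ x y → Lab u x → Lab v y → x ≼ y

  record IsCoLexRel (R : V → V → Set) : Set where
    field
      reflexive : ∀ {u v} → u ≈ v → R u v
      respects  : ∀ {u u' v v'} → u ≈ u' → v ≈ v' → R u v → R u' v'
      axiom1 : ∀ {u v} → ¬ (u ≈ v) → R u v → u ∠ v
      axiom2 : ∀ {u' u v' v a} → E u' u a → E v' v a →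
               ¬ (u ≈ v) → R u v → R u' v'

  record IsCoLexOrder (R : V → V → Set) : Set where
    field
      isCoLexRel : IsCoLexRel R
      antisym    : ∀ {u v} → R u v → R v u → u ≈ v
      trans      : ∀ {u v w} → R u v → R v w → R u w

  IsMaxCoLexRel : (V → V → Set) → Set₁
  IsMaxCoLexRel R =
    IsCoLexRel R × (∀ (S : V → V → Set) → IsCoLexRel S → ∀ {u v} → S u v → R u v)

  IsMaxCoLexOrder : (V → V → Set) → Set₁
  IsMaxCoLexOrder R =
    IsCoLexOrder R × (∀ (S : V → V → Set) → IsCoLexOrder S → ∀ {u v} → S u v → R u v)

open CoLex public

record Graph (k : ℕ) : Set where
  field
    n    : ℕ
    edge : Fin n → Fin n → Fin k → Bool

open Graph public

Node : ∀ {k} → Graph k → Set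
Node G = Fin (n G)

Edge : ∀ {k} (G : Graph k) → Node G → Node G → Fin k → Set
Edge G u v a = edge G u v a ≡ true

Equiv : ∀ {V : Set} → (V → V → Set) → V → V → Set
Equiv R u v = R u v × R v u

QEdge : ∀ {k} (G : Graph k) → (Node G → Node G → Set) →
        Node G → Node G → Fin k → Set
QEdge G R u v a = ∃[ u' ] ∃[ v' ] (Equiv R u' u × Equiv R v' v × Edge G u' v' a)

-- ≤_G is transitive because ≤_G ∘ ≤_G is co-lex: if u ≤ w ≤ v with u, w, v
-- distinct, every label of w lies between the labels of u and v, so when u and v
-- are entered by a-edges from u' and v', so is w, from some w', and Axiom 2 twice
-- gives u' ≤ w' ≤ v'.
--
-- A class of G/≤_G without incoming edges consists of nodes without incoming
-- edges (Axiom 1 for ≤_G), so labels of classes are labels of representatives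
-- and both axioms descend to the quotient.  Conversely, if S is co-lex on G/≤_G
-- then ≤_G ∪ S is co-lex on G: pairs of S with u ∼ v are already in ≤_G, and the
-- others satisfy the axioms in the quotient.
--
-- Constructively, none of equality of nodes, having an incoming edge, or u ∼ v
-- is decidable, so these case distinctions are made under double negation.
-- That suffices because label comparison is decidable, so Axiom 1 is ¬¬-stable,
-- and the ¬¬-closure of a relation satisfying the axioms classically is co-lex.
module Submission where

open import Defs hiding (Lab; _∠_)
open import Data.Nat using (ℕ)
open import Data.Empty using (⊥-elim)
open import Data.Fin using (Fin)
import Data.Fin.Properties as Fin
open import Data.Maybe using (Maybe; just; nothing)
open import Data.Product using (_×_; _,_; proj₁; proj₂; ∃; ∃-syntax)
open import Data.Sum using (_⊎_; inj₁; inj₂)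
open import Effect.Monad using (RawMonad)
open import Level using (0ℓ)
open import Relation.Binary.Construct.Union using (_∪_)
open import Relation.Binary.PropositionalEquality using (_≡_; _≢_; refl; subst)
open import Relation.Nullary using (¬_; Dec; yes; no)
open import Relation.Nullary.Decidable using (decidable-stable; ¬¬-excluded-middle)
open import Relation.Nullary.Negation using (¬¬-Monad; ¬¬-map)

open RawMonad (¬¬-Monad {0ℓ}) using (pure; _>>=_)

module _ {k : ℕ} where

  ≼-trans : ∀ {x y z : Maybe (Fin k)} → x ≼ y → y ≼ z → x ≼ z
  ≼-trans #≼        _         = #≼
  ≼-trans (a≼b a≤b) (a≼b b≤c) = a≼b (Fin.≤-trans a≤b b≤c)

  _≼?_ : ∀ (x y : Maybe (Fin k)) → Dec (x ≼ y)
  nothing ≼? y       = yes #≼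
  just a  ≼? nothing = no λ ()
  just a  ≼? just b  with a Fin.≤? b
  ... | yes a≤b = yes (a≼b a≤b)
  ... | no  a≰b = no λ { (a≼b a≤b) → a≰b a≤b }

  ≼-stable : ∀ {x y : Maybe (Fin k)} → ¬ ¬ (x ≼ y) → x ≼ y
  ≼-stable {x} {y} = decidable-stable (x ≼? y)

  just⋠nothing : ∀ {a : Fin k} → ¬ (just a ≼ nothing)
  just⋠nothing ()

  just-≼-antisym : ∀ {a b : Fin k} → just a ≼ just b → just b ≼ just a → a ≡ b
  just-≼-antisym (a≼b a≤b) (a≼b b≤a) = Fin.≤-antisym a≤b b≤a

module _ {k : ℕ} {V : Set} (E : V → V → Fin k → Set) where

  open CoLex _≡_ E using (Lab; _∠_)

  labelled : ∀ w → ¬ ¬ ∃ (Lab w)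
  labelled w = do
    yes (u , a , e) ← ¬¬-excluded-middle {A = ∃[ u ] ∃[ a ] E u w a}
      where no unentered → pure (nothing , unentered)
    pure (just a , u , e)

  ∠-trans : ∀ {u w v} → ∃ (Lab w) → u ∠ w → w ∠ v → u ∠ v
  ∠-trans (z , lz) u∠w w∠v x y lx ly = ≼-trans (u∠w x z lx lz) (w∠v z y lz ly)

  ∠-stable : ∀ {u v} → ¬ ¬ (u ∠ v) → u ∠ v
  ∠-stable u∠v x y lx ly = ≼-stable (¬¬-map (λ h → h x y lx ly) u∠v)

  ∠-sandwich : ∀ {u' u w v' v a} → E u' u a → E v' v a →
               u ∠ w → w ∠ v → ∃ (Lab w) → ∃[ w' ] E w' w a
  ∠-sandwich {a = a} eu ev u∠w w∠v (nothing , lw) =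
    ⊥-elim (just⋠nothing (u∠w (just a) nothing (_ , eu) lw))
  ∠-sandwich {a = a} eu ev u∠w w∠v (just c , w' , ew) =
    w' , subst (E w' _) c≡a ew
    where
      c≡a : c ≡ a
      c≡a = just-≼-antisym (w∠v (just c) (just a) (w' , ew) (_ , ev))
                           (u∠w (just a) (just c) (_ , eu) (w' , ew))

  record IsCoLexRel¬¬ (S : V → V → Set) : Set where
    field
      reflexive : ∀ {u} → S u u
      axiom1    : ∀ {u v} → u ≢ v → S u v → ¬ ¬ (u ∠ v)
      axiom2    : ∀ {u' u v' v a} → E u' u a → E v' v a →
                  u ≢ v → S u v → ¬ ¬ S u' v'

  ¬¬-isCoLexRel : ∀ {S} → IsCoLexRel¬¬ S → IsCoLexRel _≡_ E (λ u v → ¬ ¬ S u v)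
  ¬¬-isCoLexRel S¬¬ = record
    { reflexive = λ { refl → pure S.reflexive }
    ; respects  = λ { refl refl s → s }
    ; axiom1    = λ u≢v s → ∠-stable (s >>= S.axiom1 u≢v)
    ; axiom2    = λ eu ev u≢v s → s >>= S.axiom2 eu ev u≢v
    }
    where module S = IsCoLexRel¬¬ S¬¬

  QuotEdge : (V → V → Set) → V → V → Fin k → Set
  QuotEdge R u v a = ∃[ u' ] ∃[ v' ] (Equiv R u' u × Equiv R v' v × E u' v' a)

  module Maximum (R : V → V → Set) (maxR : IsMaxCoLexRel _≡_ E R) where

    private
      module R = IsCoLexRel (proj₁ maxR)

    R-refl : ∀ {u} → R u u
    R-refl = R.reflexive refl

    ⊆-maximum : ∀ {S} → IsCoLexRel¬¬ S → ∀ {u v} → S u v → R u v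
    ⊆-maximum S¬¬ s = proj₂ maxR _ (¬¬-isCoLexRel S¬¬) (pure s)

    R² : V → V → Set
    R² u v = ∃[ w ] (R u w × R w v)

    R²-isCoLexRel¬¬ : IsCoLexRel¬¬ R²
    R²-isCoLexRel¬¬ = record
      { reflexive = _ , R-refl , R-refl
      ; axiom1    = axiom1
      ; axiom2    = axiom2
      }
      where
        axiom1 : ∀ {u v} → u ≢ v → R² u v → ¬ ¬ (u ∠ v)
        axiom1 u≢v (w , uw , wv) = do
          no u≢w ← ¬¬-excluded-middle where yes refl → pure (R.axiom1 u≢v wv)
          no w≢v ← ¬¬-excluded-middle where yes refl → pure (R.axiom1 u≢v uw)
          lw ← labelled w
          pure (∠-trans lw (R.axiom1 u≢w uw) (R.axiom1 w≢v wv))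

        axiom2 : ∀ {u' u v' v a} → E u' u a → E v' v a →
                 u ≢ v → R² u v → ¬ ¬ R² u' v'
        axiom2 eu ev u≢v (w , uw , wv) = do
          no u≢w ← ¬¬-excluded-middle
            where yes refl → pure (_ , R.axiom2 eu ev u≢v wv , R-refl)
          no w≢v ← ¬¬-excluded-middle
            where yes refl → pure (_ , R-refl , R.axiom2 eu ev u≢v uw)
          lw ← labelled w
          let w' , ew = ∠-sandwich eu ev (R.axiom1 u≢w uw) (R.axiom1 w≢v wv) lw
          pure (w' , R.axiom2 eu ew u≢w uw , R.axiom2 ew ev w≢v wv)

    R-trans : ∀ {u v w} → R u v → R v w → R u w
    R-trans uv vw = ⊆-maximum R²-isCoLexRel¬¬ (_ , uv , vw)

    _~_ : V → V → Set
    _~_ = Equiv R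

    ~-refl : ∀ {u} → u ~ u
    ~-refl = R-refl , R-refl

    R-respects-~ : ∀ {u u' v v'} → u ~ u' → v ~ v' → R u v → R u' v'
    R-respects-~ (_ , u'u) (vv' , _) uv = R-trans u'u (R-trans uv vv')

    ≢-of-≁ : ∀ {u v u₀ v₀} → ¬ (u ~ v) → u₀ ~ u → v₀ ~ v → u₀ ≢ v₀
    ≢-of-≁ u≁v (u₀u , uu₀) (v₀v , vv₀) refl = u≁v (R-trans uu₀ v₀v , R-trans vv₀ u₀u)

    open CoLex _~_ (QuotEdge R) using () renaming (Lab to Lab/; _∠_ to _∠/_)

    edge-quotient : ∀ {u v a} → E u v a → QuotEdge R u v a
    edge-quotient e = _ , _ , ~-refl , ~-refl , e

    label-quotient : ∀ {v x} → Lab v x → Lab/ v x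
    label-quotient {x = just a} (u , e) = u , edge-quotient e
    label-quotient {v} {nothing} unentered (_ , a , u' , v₀ , _ , (v₀v , _) , e) =
      just⋠nothing (R.axiom1 v₀≢v v₀v (just a) nothing (u' , e) unentered)
      where
        v₀≢v : v₀ ≢ v
        v₀≢v refl = unentered (u' , a , e)

    label-representative : ∀ {v x} → Lab/ v x → ∃[ v₀ ] (v₀ ~ v × Lab v₀ x)
    label-representative {x = just a} (_ , u' , v₀ , _ , v₀~v , e) = v₀ , v₀~v , u' , e
    label-representative {v} {nothing} unentered =
      v , ~-refl , λ (u , a , e) → unentered (u , a , edge-quotient e)

    ∠-of-∠/ : ∀ {u v} → u ∠/ v → u ∠ v
    ∠-of-∠/ u∠v x y lx ly = u∠v x y (label-quotient lx) (label-quotient ly)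

    R-isCoLexRel/ : IsCoLexRel _~_ (QuotEdge R) R
    R-isCoLexRel/ = record
      { reflexive = proj₁
      ; respects  = R-respects-~
      ; axiom1    = axiom1
      ; axiom2    = axiom2
      }
      where
        axiom1 : ∀ {u v} → ¬ (u ~ v) → R u v → u ∠/ v
        axiom1 u≁v uv x y lx ly =
          let u₀ , (u₀u , uu₀) , lx₀ = label-representative lx
              v₀ , (v₀v , vv₀) , ly₀ = label-representative ly
          in R.axiom1 (≢-of-≁ u≁v (u₀u , uu₀) (v₀v , vv₀))
                      (R-trans u₀u (R-trans uv vv₀)) x y lx₀ ly₀

        axiom2 : ∀ {u' u v' v a} → QuotEdge R u' u a → QuotEdge R v' v a →
                 ¬ (u ~ v) → R u v → R u' v'
        axiom2 (u'₀ , u₀ , u'₀~u' , (u₀u , uu₀) , eu)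
               (v'₀ , v₀ , v'₀~v' , (v₀v , vv₀) , ev) u≁v uv =
          R-respects-~ u'₀~u' v'₀~v'
            (R.axiom2 eu ev (≢-of-≁ u≁v (u₀u , uu₀) (v₀v , vv₀))
                      (R-trans u₀u (R-trans uv vv₀)))

    R-isCoLexOrder/ : IsCoLexOrder _~_ (QuotEdge R) R
    R-isCoLexOrder/ = record
      { isCoLexRel = R-isCoLexRel/
      ; antisym    = _,_
      ; trans      = R-trans
      }

    module _ {S} (S-colex : IsCoLexRel _~_ (QuotEdge R) S) where

      private
        module S = IsCoLexRel S-colex

      R-or-separated : ∀ {u v} → (R ∪ S) u v → ¬ ¬ (R u v ⊎ (¬ (u ~ v) × S u v))
      R-or-separated (inj₁ uv) = pure (inj₁ uv)
      R-or-separated (inj₂ s)  = do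
        no u≁v ← ¬¬-excluded-middle where yes (uv , _) → pure (inj₁ uv)
        pure (inj₂ (u≁v , s))

      R∪S-isCoLexRel¬¬ : IsCoLexRel¬¬ (R ∪ S)
      R∪S-isCoLexRel¬¬ = record
        { reflexive = inj₁ R-refl
        ; axiom1    = λ u≢v t → do
            inj₂ (u≁v , s) ← R-or-separated t
              where inj₁ uv → pure (R.axiom1 u≢v uv)
            pure (∠-of-∠/ (S.axiom1 u≁v s))
        ; axiom2    = λ eu ev u≢v t → do
            inj₂ (u≁v , s) ← R-or-separated t
              where inj₁ uv → pure (inj₁ (R.axiom2 eu ev u≢v uv))
            pure (inj₂ (S.axiom2 (edge-quotient eu) (edge-quotient ev) u≁v s))
        }

      ⊆-R : ∀ {u v} → S u v → R u v
      ⊆-R s = ⊆-maximum R∪S-isCoLexRel¬¬ (inj₂ s)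

corollary2 : ∀ {k : ℕ} (G : Graph k) (R : Node G → Node G → Set) →
    IsMaxCoLexRel _≡_ (Edge G) R →
    IsMaxCoLexRel (Equiv R) (QEdge G R) R × IsMaxCoLexOrder (Equiv R) (QEdge G R) R
corollary2 G R maxR =
  (R-isCoLexRel/   , λ _ S-colex → ⊆-R S-colex) ,
  (R-isCoLexOrder/ , λ _ S-order → ⊆-R (IsCoLexOrder.isCoLexRel S-order))
  where open Maximum (Edge G) R maxR
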